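{- For any graph $G$, $2\, i(G)\le i_{dR}(G)\le 3\, i(G)$, and these bounds are sharp.
   Context: $i(G)$ is the independent domination number: the minimum cardinality of a set that is both independent and dominating in $G$. An independent double Roman dominating function (IDRDF) on $G=(V,E)$ is a function $f:V\to\{0,1,2,3\}$ such that: every vertex $v$ with $f(v)=0$ has at least two neighbors $w$ with $f(w)=2$ or at least one neighbor $w$ with $f(w)=3$; every vertex $v$ with $f(v)=1$ has a neighbor $w$ with $f(w)\ge 2$; and $\{v: f(v)>0\}$ is independent. $i_{dR}(G)$ is the minimum weight $\sum_v f(v)$ of an IDRDF on $G$. -}

module Defs where

open import Data.Nat using (ℕ; zero; suc; _≤_; _<_)
open import Data.Bool using (Bool; true; false; T)
open import Data.Fin using (Fin)
open import Data.Fin.Subset using (Subset; _∈_; _∉_; ∣_∣)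
open import Data.Vec using (tabulate)
import Data.Vec as Vec
open import Data.Product using (Σ; ∃; _×_)
open import Data.Sum using (_⊎_)
open import Relation.Nullary using (¬_)
open import Relation.Binary.PropositionalEquality using (_≡_; _≢_)

record Graph (n : ℕ) : Set where
  field
    adj   : Fin n → Fin n → Bool
    sym   : ∀ u v → adj u v ≡ adj v u
    irrfl : ∀ v → adj v v ≡ false

open Graph public

Adj : ∀ {n} → Graph n → Fin n → Fin n → Set
Adj G u v = T (adj G u v)

Independent : ∀ {n} → Graph n → Subset n → Set
Independent G S = ∀ u v → u ∈ S → v ∈ S → ¬ Adj G u v

Dominating : ∀ {n} → Graph n → Subset n → Set
Dominating G S = ∀ v → v ∉ S → ∃ λ u → u ∈ S × Adj G u v

IndDom : ∀ {n} → Graph n → Subset n → Set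
IndDom G S = Independent G S × Dominating G S

IsIndDomNumber : ∀ {n} → Graph n → ℕ → Set
IsIndDomNumber G k =
  (∃ λ S → IndDom G S × ∣ S ∣ ≡ k) × (∀ S → IndDom G S → k ≤ ∣ S ∣)

IsIDRDF : ∀ {n} → Graph n → (Fin n → ℕ) → Set
IsIDRDF G f =
    (∀ v → f v ≤ 3)
  × (∀ v → f v ≡ 0 →
        (∃ λ w₁ → ∃ λ w₂ → w₁ ≢ w₂ × Adj G v w₁ × Adj G v w₂ × f w₁ ≡ 2 × f w₂ ≡ 2)
      ⊎ (∃ λ w → Adj G v w × f w ≡ 3))
  × (∀ v → f v ≡ 1 → ∃ λ w → Adj G v w × 2 ≤ f w)
  × (∀ u v → 0 < f u → 0 < f v → ¬ Adj G u v)

weight : ∀ {n} → (Fin n → ℕ) → ℕ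
weight f = Vec.sum (tabulate f)

IsIDRNumber : ∀ {n} → Graph n → ℕ → Set
IsIDRNumber G m =
  (∃ λ f → IsIDRDF G f × weight f ≡ m) × (∀ f → IsIDRDF G f → m ≤ weight f)

-- Upper bound: if S is an independent dominating set, then 3·[S] (value 3 on S, 0 elsewhere)
-- is an IDRDF of weight 3·|S|.
-- Lower bound: an IDRDF f never takes the value 1 (a vertex of value 1 would need a positive
-- neighbour, against independence), so f ≥ 2·[supp f] pointwise; and supp f is an independent
-- dominating set (every vertex of value 0 has a positive neighbour).  Hence i_dR ≥ 2·i.
-- Both numbers exist: a graph has an independent dominating set (an independent set of maximum
-- size dominates), the candidate sets and the {0,1,2,3}-valued functions on Fin n can be searched
-- exhaustively, and a decidable predicate on a searchable type has a witness of minimal measure.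
-- Sharpness: K₁ has i = 1 and i_dR = 2; K₂ has i = 1 and i_dR = 3.  Both have a vertex adjacent
-- to all others, which forces i = 1.
module Submission where

open import Defs
open import Data.Nat using (ℕ; zero; suc; _+_; _*_; _∸_; _≤_; _<_; _<ᵇ_; z≤n; s≤s; _≤?_; _≟_)
open import Data.Nat.Properties
  using (≤-refl; ≤-trans; ≤-reflexive; ≰⇒>; <⇒≱; n≢0⇒n>0; +-mono-≤; m≤m+n; m≤n+m;
         *-zeroʳ; *-suc; *-monoʳ-≤; ∸-monoʳ-<)
open import Data.Bool using (Bool; true; false; T; if_then_else_)
open import Data.Fin as Fin using (Fin; toℕ; fromℕ<)
open import Data.Fin.Properties using (any?; all?; toℕ-fromℕ<)
open import Data.Fin.Subset using (Subset; _∈_; _∉_; _⊆_; _∪_; ⁅_⁆; ∣_∣) renaming (⊥ to ∅)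
open import Data.Fin.Subset.Properties
  using (_∈?_; anySubset?; ∉⊥; ∣p∣≤n; p⊆q⇒∣p∣≤∣q∣; p⊂q⇒∣p∣<∣q∣; p⊆p∪q; q⊆p∪q; x∈p∪q⁻;
         x∈⁅x⁆; x∈⁅y⁆⇒x≡y; ∣⁅x⁆∣≡1)
open import Data.Vec as Vec using (Vec; []; _∷_; tabulate; lookup)
open import Data.Vec.Properties using (tabulate∘lookup; tabulate-cong; lookup∘tabulate; []=⇒lookup; lookup⇒[]=)
open import Data.Product using (Σ; ∃; _×_; _,_; proj₁; proj₂)
open import Data.Sum using (_⊎_; inj₁; inj₂)
import Data.Sum as Sum
open import Data.Empty using (⊥-elim)
open import Data.Unit using (tt)
open import Relation.Nullary using (Dec; yes; no; ¬_)
open import Relation.Nullary.Decidable using (T?; ¬?; _×-dec_; _⊎-dec_; _→-dec_; map′)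
open import Relation.Unary using (Decidable)
open import Relation.Binary.PropositionalEquality
  using (_≡_; _≢_; _≗_; refl; trans; cong; subst)
  renaming (sym to ≡-sym)

Searchable : Set → Set₁
Searchable A = ∀ {P : A → Set} → Decidable P → Dec (∃ P)

searchable-Vec : ∀ {A} → Searchable A → ∀ {n} → Searchable (Vec A n)
searchable-Vec searchA {zero} P? =
  map′ (λ p → [] , p) (λ { ([] , p) → p }) (P? [])
searchable-Vec searchA {suc n} P? =
  map′ (λ { (x , xs , p) → x ∷ xs , p }) (λ { (x ∷ xs , p) → x , xs , p })
       (searchA λ x → searchable-Vec searchA (λ xs → P? (x ∷ xs)))

-- By induction on a bound for the measure of a known witness:
-- either some witness lies strictly below the bound, or the known one is already minimal.
minimalWitness : ∀ {A} → Searchable A → {P : A → Set} → Decidable P → (μ : A → ℕ) →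
                 ∃ P → ∃ λ a → P a × (∀ b → P b → μ a ≤ μ b)
minimalWitness search {P} P? μ (a , pa) = below (μ a) a pa ≤-refl
  where
  below : ∀ bound a → P a → μ a ≤ bound → ∃ λ a → P a × (∀ b → P b → μ a ≤ μ b)
  below zero a pa μa≤0 = a , pa , λ b _ → ≤-trans μa≤0 z≤n
  below (suc bound) a pa μa≤ with search (λ b → P? b ×-dec (μ b ≤? bound))
  ... | yes (b , pb , μb≤) = below bound b pb μb≤
  ... | no noneBelow = a , pa , λ b pb → ≤-trans μa≤ (≰⇒> (λ μb≤ → noneBelow (b , pb , μb≤)))

module _ {n : ℕ} (G : Graph n) where

  adj-sym : ∀ {u v} → Adj G u v → Adj G v u
  adj-sym {u} {v} = subst T (Graph.sym G u v)

  independent? : Decidable (Independent G)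
  independent? S = all? λ u → all? λ v → (u ∈? S) →-dec ((v ∈? S) →-dec ¬? (T? (adj G u v)))

  dominating? : Decidable (Dominating G)
  dominating? S = all? λ v → ¬? (v ∈? S) →-dec any? λ u → (u ∈? S) ×-dec T? (adj G u v)

  indDom? : Decidable (IndDom G)
  indDom? S = independent? S ×-dec dominating? S

  isIDRDF? : Decidable (IsIDRDF G)
  isIDRDF? f =
    all? (λ v → f v ≤? 3)
    ×-dec all? (λ v → (f v ≟ 0) →-dec
      ((any? λ w₁ → any? λ w₂ → ¬? (w₁ Fin.≟ w₂) ×-dec T? (adj G v w₁) ×-dec T? (adj G v w₂)
          ×-dec (f w₁ ≟ 2) ×-dec (f w₂ ≟ 2))
       ⊎-dec (any? λ w → T? (adj G v w) ×-dec (f w ≟ 3))))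
    ×-dec all? (λ v → (f v ≟ 1) →-dec any? λ w → T? (adj G v w) ×-dec (2 ≤? f w))
    ×-dec all? λ u → all? λ v → (1 ≤? f u) →-dec ((1 ≤? f v) →-dec ¬? (T? (adj G u v)))

  IsIDRDF-resp : ∀ {f g} → f ≗ g → IsIDRDF G f → IsIDRDF G g
  IsIDRDF-resp {f} {g} f≗g (bounded , zeroCase , oneCase , indep) =
      (λ v → subst (_≤ 3) (f≗g v) (bounded v))
    , (λ v gv≡0 → Sum.map
         (λ { (w₁ , w₂ , w₁≢w₂ , a₁ , a₂ , e₁ , e₂) →
                w₁ , w₂ , w₁≢w₂ , a₁ , a₂ , trans (≡-sym (f≗g w₁)) e₁ , trans (≡-sym (f≗g w₂)) e₂ })
         (λ { (w , a , e) → w , a , trans (≡-sym (f≗g w)) e })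
         (zeroCase v (trans (f≗g v) gv≡0)))
    , (λ v gv≡1 → let (w , a , 2≤fw) = oneCase v (trans (f≗g v) gv≡1)
                  in w , a , subst (2 ≤_) (f≗g w) 2≤fw)
    , λ u v 0<gu 0<gv → indep u v (subst (0 <_) (≡-sym (f≗g u)) 0<gu)
                                  (subst (0 <_) (≡-sym (f≗g v)) 0<gv)

module _ {n : ℕ} (G : Graph n) where

  extend-independent : ∀ S v → Independent G S → ¬ (∃ λ u → u ∈ S × Adj G u v) →
                       Independent G (S ∪ ⁅ v ⁆)
  extend-independent S v indS noNbr u w u∈ w∈ a
    with x∈p∪q⁻ S ⁅ v ⁆ u∈ | x∈p∪q⁻ S ⁅ v ⁆ w∈
  ... | inj₁ u∈S | inj₁ w∈S = indS u w u∈S w∈S a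
  ... | inj₁ u∈S | inj₂ w∈v with refl ← x∈⁅y⁆⇒x≡y v w∈v = noNbr (u , u∈S , a)
  ... | inj₂ u∈v | inj₁ w∈S with refl ← x∈⁅y⁆⇒x≡y v u∈v = noNbr (w , w∈S , adj-sym G a)
  ... | inj₂ u∈v | inj₂ w∈v with refl ← x∈⁅y⁆⇒x≡y v u∈v | refl ← x∈⁅y⁆⇒x≡y v w∈v =
    subst T (Graph.irrfl G u) a

  -- An independent set of maximum size is dominating: a vertex outside it with no
  -- neighbour inside could be added, giving a strictly larger independent set.
  maximum-independent-dominates : ∀ S → Independent G S →
    (∀ T → Independent G T → n ∸ ∣ S ∣ ≤ n ∸ ∣ T ∣) → Dominating G S
  maximum-independent-dominates S indS maximum v v∉S
    with any? (λ u → (u ∈? S) ×-dec T? (adj G u v))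
  ... | yes neighbour = neighbour
  ... | no noNbr = ⊥-elim (<⇒≱ smaller (maximum S⁺ (extend-independent S v indS noNbr)))
    where
    S⁺ : Subset n
    S⁺ = S ∪ ⁅ v ⁆
    ∣S∣<∣S⁺∣ : ∣ S ∣ < ∣ S⁺ ∣
    ∣S∣<∣S⁺∣ = p⊂q⇒∣p∣<∣q∣ (p⊆p∪q ⁅ v ⁆ , v , q⊆p∪q S ⁅ v ⁆ (x∈⁅x⁆ v) , v∉S)
    smaller : n ∸ ∣ S⁺ ∣ < n ∸ ∣ S ∣
    smaller = ∸-monoʳ-< ∣S∣<∣S⁺∣ (∣p∣≤n S⁺)

  -- Minimising n ∸ |S| over independent sets (the empty one is independent) maximises |S|.
  indDom-exists : ∃ (IndDom G)
  indDom-exists =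
    let (S , indS , maximum) =
          minimalWitness anySubset? (independent? G) (λ S → n ∸ ∣ S ∣) (∅ , λ _ _ u∈∅ → ⊥-elim (∉⊥ u∈∅))
    in S , indS , maximum-independent-dominates S indS maximum

weight-cong : ∀ {n} {f g : Fin n → ℕ} → f ≗ g → weight f ≡ weight g
weight-cong f≗g = cong Vec.sum (tabulate-cong f≗g)

weight-mono : ∀ {n} (f g : Fin n → ℕ) → (∀ i → f i ≤ g i) → weight f ≤ weight g
weight-mono {zero} f g f≤g = z≤n
weight-mono {suc n} f g f≤g =
  +-mono-≤ (f≤g Fin.zero)
           (weight-mono (λ i → f (Fin.suc i)) (λ i → g (Fin.suc i)) (λ i → f≤g (Fin.suc i)))

value≤weight : ∀ {n} (f : Fin n → ℕ) i → f i ≤ weight f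
value≤weight f Fin.zero = m≤m+n _ _
value≤weight f (Fin.suc i) = ≤-trans (value≤weight (λ j → f (Fin.suc j)) i) (m≤n+m _ _)

scaled : ℕ → Bool → ℕ
scaled a b = if b then a else 0

weight-scaled : ∀ {n} a (g : Fin n → Bool) → weight (λ i → scaled a (g i)) ≡ a * ∣ tabulate g ∣
weight-scaled {zero} a g = ≡-sym (*-zeroʳ a)
weight-scaled {suc n} a g =
  step (g Fin.zero) {s = tabulate (λ i → g (Fin.suc i))} (weight-scaled a (λ i → g (Fin.suc i)))
  where
  step : ∀ b {w s} → w ≡ a * ∣ s ∣ → scaled a b + w ≡ a * ∣ b ∷ s ∣
  step true {w} {s} w≡ = trans (cong (a +_) w≡) (≡-sym (*-suc a ∣ s ∣))
  step false w≡ = w≡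

weight-scaled-subset : ∀ {n} a (S : Subset n) → weight (λ i → scaled a (lookup S i)) ≡ a * ∣ S ∣
weight-scaled-subset a S = trans (weight-scaled a (lookup S)) (cong (λ T → a * ∣ T ∣) (tabulate∘lookup S))

∈-tabulate⁺ : ∀ {n} (g : Fin n → Bool) {i} → g i ≡ true → i ∈ tabulate g
∈-tabulate⁺ g {i} gi = lookup⇒[]= i (tabulate g) (trans (lookup∘tabulate g i) gi)

∈-tabulate⁻ : ∀ {n} (g : Fin n → Bool) {i} → i ∈ tabulate g → g i ≡ true
∈-tabulate⁻ g {i} i∈ = trans (≡-sym (lookup∘tabulate g i)) ([]=⇒lookup i∈)

module _ {n : ℕ} (G : Graph n) where

  threefold : Subset n → Fin n → ℕ
  threefold S i = scaled 3 (lookup S i)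

  threefold-IDRDF : ∀ S → IndDom G S → IsIDRDF G (threefold S)
  threefold-IDRDF S (indS , domS) =
      (λ v → at-most-3 (lookup S v))
    , (λ v value0 → let (u , u∈S , a) = domS v (zero⇒∉ v value0)
                    in inj₂ (u , adj-sym G a , cong (scaled 3) ([]=⇒lookup u∈S)))
    , (λ v value1 → ⊥-elim (not-1 (lookup S v) value1))
    , λ u v 0<u 0<v → indS u v (positive⇒∈ u 0<u) (positive⇒∈ v 0<v)
    where
    at-most-3 : ∀ b → scaled 3 b ≤ 3
    at-most-3 true = ≤-refl
    at-most-3 false = z≤n
    not-1 : ∀ b → scaled 3 b ≢ 1
    not-1 true ()
    not-1 false ()
    zero⇒∉ : ∀ v → threefold S v ≡ 0 → v ∉ S
    zero⇒∉ v value0 v∈S with lookup S v | []=⇒lookup v∈S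
    zero⇒∉ v () v∈S | true | refl
    positive⇒∈ : ∀ u → 0 < threefold S u → u ∈ S
    positive⇒∈ u 0<u with lookup S u in eq
    ... | true = lookup⇒[]= u S eq

support : ∀ {n} → (Fin n → ℕ) → Subset n
support f = tabulate (λ i → 0 <ᵇ f i)

∈-support⁺ : ∀ {n} (f : Fin n → ℕ) {i} → 0 < f i → i ∈ support f
∈-support⁺ f {i} 0<fi = ∈-tabulate⁺ (λ j → 0 <ᵇ f j) (positive (f i) 0<fi)
  where
  positive : ∀ x → 0 < x → (0 <ᵇ x) ≡ true
  positive (suc x) _ = refl

∈-support⁻ : ∀ {n} (f : Fin n → ℕ) {i} → i ∈ support f → 0 < f i
∈-support⁻ f {i} i∈ = positive (f i) (∈-tabulate⁻ (λ j → 0 <ᵇ f j) i∈)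
  where
  positive : ∀ x → (0 <ᵇ x) ≡ true → 0 < x
  positive (suc x) _ = s≤s z≤n

module _ {n : ℕ} (G : Graph n) where

  -- An IDRDF takes no value 1: the required neighbour of value ≥ 2 would be a positive
  -- neighbour of a positive vertex.
  IDRDF-no-1 : ∀ f → IsIDRDF G f → ∀ v → f v ≢ 1
  IDRDF-no-1 f (_ , _ , oneCase , indep) v fv≡1 =
    let (w , a , 2≤fw) = oneCase v fv≡1
    in indep v w (subst (0 <_) (≡-sym fv≡1) (s≤s z≤n)) (≤-trans (s≤s z≤n) 2≤fw) a

  zero⇒positive-neighbour : ∀ f → IsIDRDF G f → ∀ v → f v ≡ 0 → ∃ λ w → Adj G v w × 0 < f w
  zero⇒positive-neighbour f (_ , zeroCase , _) v fv≡0 with zeroCase v fv≡0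
  ... | inj₁ (w , _ , _ , a , _ , fw≡2 , _) = w , a , subst (0 <_) (≡-sym fw≡2) (s≤s z≤n)
  ... | inj₂ (w , a , fw≡3) = w , a , subst (0 <_) (≡-sym fw≡3) (s≤s z≤n)

  support-indDom : ∀ f → IsIDRDF G f → IndDom G (support f)
  support-indDom f idr@(_ , _ , _ , indep) =
      (λ u v u∈ v∈ → indep u v (∈-support⁻ f u∈) (∈-support⁻ f v∈))
    , λ v v∉ →
        let (w , a , 0<fw) = zero⇒positive-neighbour f idr v
                               (not-positive (f v) (λ 0<fv → v∉ (∈-support⁺ f 0<fv)))
        in w , ∈-support⁺ f 0<fw , adj-sym G a
    where
    not-positive : ∀ x → ¬ 0 < x → x ≡ 0
    not-positive zero _ = refl
    not-positive (suc x) h = ⊥-elim (h (s≤s z≤n))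

  -- Pointwise f ≥ 2·[supp f], since no value is 1; summing gives the weight bound.
  support-weight : ∀ f → IsIDRDF G f → 2 * ∣ support f ∣ ≤ weight f
  support-weight f idr = begin
    2 * ∣ support f ∣                   ≡⟨ weight-scaled 2 (λ i → 0 <ᵇ f i) ⟨
    weight (λ i → scaled 2 (0 <ᵇ f i))  ≤⟨ weight-mono _ f (λ i → twice-indicator (f i) (IDRDF-no-1 f idr i)) ⟩
    weight f                            ∎
    where
    open Data.Nat.Properties.≤-Reasoning
    twice-indicator : ∀ x → x ≢ 1 → scaled 2 (0 <ᵇ x) ≤ x
    twice-indicator zero _ = z≤n
    twice-indicator (suc zero) x≢1 = ⊥-elim (x≢1 refl)
    twice-indicator (suc (suc x)) _ = s≤s (s≤s z≤n)

  IDRDF-lower : ∀ k f → IsIndDomNumber G k → IsIDRDF G f → 2 * k ≤ weight f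
  IDRDF-lower k f (_ , minimal) idr =
    ≤-trans (*-monoʳ-≤ 2 (minimal (support f) (support-indDom f idr))) (support-weight f idr)

-- Existence of i(G) and i_dR(G).  IDRDFs are coded by vectors over Fin 4, which are searchable.

decode : ∀ {n} → Vec (Fin 4) n → Fin n → ℕ
decode code i = toℕ (lookup code i)

encode : ∀ {n} (f : Fin n → ℕ) → (∀ i → f i ≤ 3) → Vec (Fin 4) n
encode f bounded = tabulate (λ i → fromℕ< (s≤s (bounded i)))

decode-encode : ∀ {n} (f : Fin n → ℕ) bounded → decode (encode f bounded) ≗ f
decode-encode f bounded i =
  trans (cong toℕ (lookup∘tabulate _ i)) (toℕ-fromℕ< (s≤s (bounded i)))

module _ {n : ℕ} (G : Graph n) where

  indDomNumber-exists : ∃ (IsIndDomNumber G)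
  indDomNumber-exists =
    let (S , ids , minimal) = minimalWitness anySubset? (indDom? G) ∣_∣ (indDom-exists G)
    in ∣ S ∣ , (S , ids , refl) , minimal

  coded : ∀ f → IsIDRDF G f →
          ∃ λ code → IsIDRDF G (decode code) × weight (decode code) ≡ weight f
  coded f idr = encode f (proj₁ idr)
              , IsIDRDF-resp G (λ i → ≡-sym (decode-encode f (proj₁ idr) i)) idr
              , weight-cong (decode-encode f (proj₁ idr))

  -- Minimise the weight over codes, starting from a threefold indicator; any IDRDF is
  -- compared with the minimum through its code.
  IDRNumber-exists : ∃ (IsIDRNumber G)
  IDRNumber-exists =
    let (S , ids) = indDom-exists G
        (code₀ , idr₀ , _) = coded (threefold G S) (threefold-IDRDF G S ids)
        (code , idr , minimal) =
          minimalWitness (searchable-Vec any?) (λ c → isIDRDF? G (decode c))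
                         (λ c → weight (decode c)) (code₀ , idr₀)
    in weight (decode code) , (decode code , idr , refl)
     , λ f idrf → let (c , idrc , same) = coded f idrf
                  in subst (weight (decode code) ≤_) same (minimal c idrc)

  bounds : ∀ k m → IsIndDomNumber G k → IsIDRNumber G m → 2 * k ≤ m × m ≤ 3 * k
  bounds k m iG@((S , ids , ∣S∣≡k) , _) ((f , idr , wf) , minimalF) =
      subst (2 * k ≤_) wf (IDRDF-lower G k f iG idr)
    , ≤-trans (minimalF (threefold G S) (threefold-IDRDF G S ids))
              (≤-reflexive (trans (weight-scaled-subset 3 S) (cong (3 *_) ∣S∣≡k)))

∈⇒nonempty : ∀ {n} {S : Subset n} {x} → x ∈ S → 1 ≤ ∣ S ∣
∈⇒nonempty {S = S} {x} x∈S = ≤-trans (≤-reflexive (≡-sym (∣⁅x⁆∣≡1 x))) (p⊆q⇒∣p∣≤∣q∣ ⁅x⁆⊆S)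
  where
  ⁅x⁆⊆S : ⁅ x ⁆ ⊆ S
  ⁅x⁆⊆S y∈ with refl ← x∈⁅y⁆⇒x≡y x y∈ = x∈S

module _ {n : ℕ} (G : Graph n) where

  universal⇒indDom : ∀ v → (∀ w → w ≢ v → Adj G v w) → IndDom G ⁅ v ⁆
  universal⇒indDom v universal = independent , dominating
    where
    independent : Independent G ⁅ v ⁆
    independent u w u∈ w∈ a with refl ← x∈⁅y⁆⇒x≡y v u∈ | refl ← x∈⁅y⁆⇒x≡y v w∈ =
      subst T (Graph.irrfl G u) a
    dominating : Dominating G ⁅ v ⁆
    dominating w w∉ = v , x∈⁅x⁆ v , universal w (λ { refl → w∉ (x∈⁅x⁆ v) })

  universal⇒indDomNumber-1 : ∀ v → (∀ w → w ≢ v → Adj G v w) → IsIndDomNumber G 1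
  universal⇒indDomNumber-1 v universal =
      (⁅ v ⁆ , universal⇒indDom v universal , ∣⁅x⁆∣≡1 v)
    , λ S (_ , domS) → nonempty S domS
    where
    nonempty : ∀ S → Dominating G S → 1 ≤ ∣ S ∣
    nonempty S domS with v ∈? S
    ... | yes v∈S = ∈⇒nonempty v∈S
    ... | no v∉S = ∈⇒nonempty (proj₁ (proj₂ (domS v v∉S)))

  -- Under an IDRDF, a vertex of value 0 whose only neighbour is u forces f u = 3:
  -- two distinct neighbours of value 2 are not available.
  leaf-forces-3 : ∀ f → IsIDRDF G f → ∀ v u → (∀ w → Adj G v w → w ≡ u) → f v ≡ 0 → f u ≡ 3
  leaf-forces-3 f (_ , zeroCase , _) v u only-u fv≡0 with zeroCase v fv≡0
  ... | inj₁ (w₁ , w₂ , w₁≢w₂ , a₁ , a₂ , _) = ⊥-elim (w₁≢w₂ (trans (only-u w₁ a₁) (≡-sym (only-u w₂ a₂))))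
  ... | inj₂ (w , a , fw≡3) with refl ← only-u w a = fw≡3

  adjacent⇒one-zero : ∀ f → IsIDRDF G f → ∀ u v → Adj G u v → f u ≡ 0 ⊎ f v ≡ 0
  adjacent⇒one-zero f (_ , _ , _ , indep) u v a with f u ≟ 0 | f v ≟ 0
  ... | yes fu≡0 | _ = inj₁ fu≡0
  ... | no _ | yes fv≡0 = inj₂ fv≡0
  ... | no fu≢0 | no fv≢0 = ⊥-elim (indep u v (n≢0⇒n>0 fu≢0) (n≢0⇒n>0 fv≢0) a)

-- K₁: i = 1 and i_dR = 2 (the constant 2 is an IDRDF; the lower bound gives the rest).
K₁ : Graph 1
K₁ = record { adj = λ _ _ → false ; sym = λ _ _ → refl ; irrfl = λ _ → refl }

K₁-indDomNumber : IsIndDomNumber K₁ 1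
K₁-indDomNumber = universal⇒indDomNumber-1 K₁ Fin.zero λ { Fin.zero 0≢0 → ⊥-elim (0≢0 refl) }

K₁-IDRNumber : IsIDRNumber K₁ 2
K₁-IDRNumber =
    ((λ _ → 2) , ((λ _ → s≤s (s≤s z≤n)) , (λ _ ()) , (λ _ ()) , λ _ _ _ _ ()) , refl)
  , λ f idr → IDRDF-lower K₁ 1 f K₁-indDomNumber idr

-- K₂: i = 1 and i_dR = 3 (value 3 on one end; some end has value 0, forcing a 3).
K₂-adj : Fin 2 → Fin 2 → Bool
K₂-adj Fin.zero Fin.zero = false
K₂-adj Fin.zero (Fin.suc Fin.zero) = true
K₂-adj (Fin.suc Fin.zero) Fin.zero = true
K₂-adj (Fin.suc Fin.zero) (Fin.suc Fin.zero) = false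

K₂ : Graph 2
K₂ = record { adj = K₂-adj ; sym = symmetric ; irrfl = irreflexive }
  where
  symmetric : ∀ u v → K₂-adj u v ≡ K₂-adj v u
  symmetric Fin.zero Fin.zero = refl
  symmetric Fin.zero (Fin.suc Fin.zero) = refl
  symmetric (Fin.suc Fin.zero) Fin.zero = refl
  symmetric (Fin.suc Fin.zero) (Fin.suc Fin.zero) = refl
  irreflexive : ∀ v → K₂-adj v v ≡ false
  irreflexive Fin.zero = refl
  irreflexive (Fin.suc Fin.zero) = refl

K₂-other : Fin 2 → Fin 2
K₂-other Fin.zero = Fin.suc Fin.zero
K₂-other (Fin.suc Fin.zero) = Fin.zero

K₂-only-neighbour : ∀ v w → Adj K₂ v w → w ≡ K₂-other v
K₂-only-neighbour Fin.zero (Fin.suc Fin.zero) _ = refl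
K₂-only-neighbour (Fin.suc Fin.zero) Fin.zero _ = refl
K₂-only-neighbour Fin.zero Fin.zero ()
K₂-only-neighbour (Fin.suc Fin.zero) (Fin.suc Fin.zero) ()

K₂-universal : ∀ w → w ≢ Fin.zero → Adj K₂ Fin.zero w
K₂-universal Fin.zero 0≢0 = ⊥-elim (0≢0 refl)
K₂-universal (Fin.suc Fin.zero) _ = tt

K₂-indDomNumber : IsIndDomNumber K₂ 1
K₂-indDomNumber = universal⇒indDomNumber-1 K₂ Fin.zero K₂-universal

K₂-IDRNumber : IsIDRNumber K₂ 3
K₂-IDRNumber =
    ( threefold K₂ ⁅ Fin.zero ⁆
    , threefold-IDRDF K₂ ⁅ Fin.zero ⁆ (universal⇒indDom K₂ Fin.zero K₂-universal)
    , refl )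
  , at-least-3
  where
  zero-forces-3 : ∀ f → IsIDRDF K₂ f → ∀ v → f v ≡ 0 → 3 ≤ weight f
  zero-forces-3 f idrf v fv≡0 =
    subst (_≤ weight f) (leaf-forces-3 K₂ f idrf v (K₂-other v) (K₂-only-neighbour v) fv≡0)
          (value≤weight f (K₂-other v))
  at-least-3 : ∀ f → IsIDRDF K₂ f → 3 ≤ weight f
  at-least-3 f idrf with adjacent⇒one-zero K₂ f idrf Fin.zero (Fin.suc Fin.zero) tt
  ... | inj₁ f0≡0 = zero-forces-3 f idrf Fin.zero f0≡0
  ... | inj₂ f1≡0 = zero-forces-3 f idrf (Fin.suc Fin.zero) f1≡0

proposition11 :
    ((n : ℕ) (G : Graph n) →
        (∃ λ k → IsIndDomNumber G k)
      × (∃ λ m → IsIDRNumber G m)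
      × (∀ k m → IsIndDomNumber G k → IsIDRNumber G m → 2 * k ≤ m × m ≤ 3 * k))
    × (∃ λ n → Σ (Graph (suc n)) λ G → ∃ λ k → ∃ λ m →
          IsIndDomNumber G k × IsIDRNumber G m × m ≡ 2 * k)
    × (∃ λ n → Σ (Graph (suc n)) λ G → ∃ λ k → ∃ λ m →
          IsIndDomNumber G k × IsIDRNumber G m × m ≡ 3 * k)
proposition11 =
    (λ n G → indDomNumber-exists G , IDRNumber-exists G , bounds G)
  , (0 , K₁ , 1 , 2 , K₁-indDomNumber , K₁-IDRNumber , refl)
  , (1 , K₂ , 1 , 3 , K₂-indDomNumber , K₂-IDRNumber , refl)
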